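{- Let $S$ and $U$ be two sets of constraint applications, let $X$ be the set of variables occurring in $S$ and $Y$ the set of variables occurring in $U$. If $S$ isomorphically implies $U$, $|X|\ge |Y|$, and $X\cap Y=\emptyset$, then there exists a permutation $\pi$ of $X\cup Y$ such that $\pi(S)\Rightarrow U$ and $\pi(Y)\cap Y=\emptyset$.
   Context: A constraint application is $C(z_1,\ldots,z_k)$ for a Boolean function $C:\{0,1\}^k\to\{0,1\}$ and variables $z_i$; sets of constraint applications are read as conjunctions. For a permutation $\pi$ of variables, $\pi(S)$ simultaneously replaces each variable $x$ by $\pi(x)$. $S$ isomorphically implies $U$ if there is a permutation $\pi$ of the variables occurring in $S\cup U$ with $\pi(S)\Rightarrow U$. -}

module Defs where

open import Data.Bool using (Bool; true)
open import Data.Nat using (ℕ; _≥_)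
open import Data.Nat.Properties using (_≟_)
open import Data.Vec using (Vec; toList)
import Data.Vec as Vec
open import Data.List using (List; []; _∷_; _++_; concatMap; length; deduplicate)
import Data.List as List
open import Data.List.Relation.Unary.All using (All)
open import Data.List.Membership.Propositional using (_∈_; _∉_)
open import Data.Product using (Σ; _×_)
open import Function.Bundles using (_↔_; Inverse)
open import Relation.Binary.PropositionalEquality using (_≡_)

Var : Set
Var = ℕ

record ConstraintApp : Set where
  constructor app
  field
    arity : ℕ
    fn    : Vec Bool arity → Bool
    args  : Vec Var arity

open ConstraintApp public

ConstraintSet : Set
ConstraintSet = List ConstraintApp

Assignment : Set
Assignment = Var → Bool

satApp : Assignment → ConstraintApp → Set
satApp α c = fn c (Vec.map α (args c)) ≡ true

sat : Assignment → ConstraintSet → Set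
sat α S = All (satApp α) S

_⇒_ : ConstraintSet → ConstraintSet → Set
S ⇒ U = (α : Assignment) → sat α S → sat α U

-- variables occurring (as a list, possibly with repetitions)
vars : ConstraintSet → List Var
vars = concatMap (λ c → toList (args c))

numVars : ConstraintSet → ℕ
numVars S = length (deduplicate _≟_ (vars S))

rename : (Var → Var) → ConstraintSet → ConstraintSet
rename π = List.map (λ c → app (arity c) (fn c) (Vec.map π (args c)))

-- π is a permutation of the variables occurring in S ∪ U:
-- a bijection of Var that is the identity outside vars(S) ∪ vars(U)
-- (hence restricts to a bijection of vars(S) ∪ vars(U)).
IsPermOf : (Var ↔ Var) → List Var → Set
IsPermOf π V = (x : Var) → x ∉ V → Inverse.to π x ≡ x

IsoImplies : ConstraintSet → ConstraintSet → Set
IsoImplies S U = Σ (Var ↔ Var) λ π →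
  IsPermOf π (vars S ++ vars U) × (rename (Inverse.to π) S ⇒ U)

-- Let π witness the isomorphic implication. While some y ∈ Y has π y ∈ Y, π maps
-- X ∪ {y} injectively, so it cannot map all of X into Y (since |X| ≥ |Y| and
-- y ∉ X); pick x ∈ X with π x ∉ Y and compose π with the transposition of π x and
-- π y. Now y leaves Y, the other points of Y keep their images, and π(S) ⇒ U survives
-- because a model α of the new π(S), read through v ↦ (v = π x ? π y : v), is a model
-- of the old π(S) that agrees with α on Y.
module Submission where

open import Defs
open import Data.Nat using (_≥_; _≤_; _+_; suc; s≤s; z≤n)
open import Data.Nat.Properties using (_≟_; ≤-trans; +-suc; <-irrefl; module ≤-Reasoning)
open import Data.List using (List; []; _∷_; _++_; length; deduplicate)
import Data.List as List
open import Data.List.Properties using (length-++; length-map)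
open import Data.Vec using (Vec; toList)
import Data.Vec as Vec
open import Data.Vec.Properties using (map-∘)
open import Data.List.Relation.Unary.All using (All; []; _∷_)
import Data.List.Relation.Unary.All as All
open import Data.List.Relation.Unary.All.Properties using (map⁺; map⁻; ¬All⇒Any¬)
open import Data.List.Relation.Unary.Any using (here; there)
open import Data.List.Relation.Unary.Unique.Propositional using (Unique)
open import Data.List.Relation.Unary.AllPairs using (_∷_)
import Data.List.Relation.Unary.Unique.Propositional.Properties as Unique
open import Data.List.Relation.Unary.Unique.DecPropositional.Properties _≟_ using (deduplicate-!)
open import Data.List.Relation.Binary.Subset.Propositional using (_⊆_)
open import Data.List.Membership.Propositional using (_∈_; _∉_; find)
open import Data.List.Membership.Propositional.Properties
  using (∈-++⁺ˡ; ∈-++⁺ʳ; ∈-++⁻; ∈-∃++; ∈-map⁻; ∈-deduplicate⁺; ∈-deduplicate⁻)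
open import Data.List.Membership.DecPropositional _≟_ using (_∈?_)
open import Data.Product using (Σ; ∃; _×_; _,_)
open import Data.Sum using (inj₁; inj₂)
open import Function using (_∘_)
open import Function.Bundles using (_↔_; Inverse; Injection; mk↔ₛ′)
open import Function.Definitions using (Injective)
open import Function.Construct.Composition using (_↔-∘_)
open import Function.Properties.Inverse using (↔⇒↣)
open import Relation.Binary.Definitions using (DecidableEquality)
open import Relation.Nullary using (¬_; yes; no; contradiction)
open import Relation.Binary.PropositionalEquality using (_≡_; _≢_; refl; sym; trans; cong; cong₂; subst)

module Transposition {a} {A : Set a} (_≟ᴬ_ : DecidableEquality A) where

  transpose : A → A → A → A
  transpose a b v with v ≟ᴬ a
  ... | yes _ = b
  ... | no _ with v ≟ᴬ b
  ...   | yes _ = a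
  ...   | no _ = v

  transpose-ˡ : ∀ a b → transpose a b a ≡ b
  transpose-ˡ a b with a ≟ᴬ a
  ... | yes _ = refl
  ... | no a≢a = contradiction refl a≢a

  transpose-ʳ : ∀ a b → transpose a b b ≡ a
  transpose-ʳ a b with b ≟ᴬ a
  ... | yes b≡a = b≡a
  ... | no _ with b ≟ᴬ b
  ...   | yes _ = refl
  ...   | no b≢b = contradiction refl b≢b

  transpose-≢ : ∀ {a b v} → v ≢ a → v ≢ b → transpose a b v ≡ v
  transpose-≢ {a} {b} {v} v≢a v≢b with v ≟ᴬ a
  ... | yes v≡a = contradiction v≡a v≢a
  ... | no _ with v ≟ᴬ b
  ...   | yes v≡b = contradiction v≡b v≢b
  ...   | no _ = refl

  transpose-involutive : ∀ a b v → transpose a b (transpose a b v) ≡ v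
  transpose-involutive a b v with v ≟ᴬ a
  ... | yes refl = transpose-ʳ a b
  ... | no v≢a with v ≟ᴬ b
  ...   | yes refl = transpose-ˡ a b
  ...   | no v≢b = transpose-≢ v≢a v≢b

  transpose↔ : A → A → A ↔ A
  transpose↔ a b = mk↔ₛ′ (transpose a b) (transpose a b)
    (transpose-involutive a b) (transpose-involutive a b)

  redirect : A → A → A → A
  redirect a b v with v ≟ᴬ a
  ... | yes _ = b
  ... | no _ = v

  redirect-≢ : ∀ {a b v} → v ≢ a → redirect a b v ≡ v
  redirect-≢ {a} {b} {v} v≢a with v ≟ᴬ a
  ... | yes v≡a = contradiction v≡a v≢a
  ... | no _ = refl

  transpose≡redirect : ∀ {a b v} → v ≢ b → transpose a b v ≡ redirect a b v
  transpose≡redirect {a} {b} {v} v≢b with v ≟ᴬ a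
  ... | yes _ = refl
  ... | no _ with v ≟ᴬ b
  ...   | yes v≡b = contradiction v≡b v≢b
  ...   | no _ = refl

open Transposition _≟_

unique⊆⇒length≤ : ∀ {a} {A : Set a} {xs ys : List A} → Unique xs → xs ⊆ ys → length xs ≤ length ys
unique⊆⇒length≤ {xs = []} _ _ = z≤n
unique⊆⇒length≤ {xs = x ∷ xs} (x∉xs ∷ xs!) xs⊆ys with ∈-∃++ (xs⊆ys (here refl))
... | us , vs , refl = begin
  suc (length xs)             ≤⟨ s≤s (unique⊆⇒length≤ xs! xs⊆us++vs) ⟩
  suc (length (us ++ vs))     ≡⟨ cong suc (length-++ us) ⟩
  suc (length us + length vs) ≡⟨ +-suc (length us) (length vs) ⟨
  length us + length (x ∷ vs) ≡⟨ length-++ us ⟨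
  length (us ++ x ∷ vs)       ∎
  where
  open ≤-Reasoning
  xs⊆us++vs : xs ⊆ us ++ vs
  xs⊆us++vs z∈xs with ∈-++⁻ us (xs⊆ys (there z∈xs))
  ... | inj₁ z∈us = ∈-++⁺ˡ z∈us
  ... | inj₂ (here refl) = contradiction refl (All.lookup x∉xs z∈xs)
  ... | inj₂ (there z∈vs) = ∈-++⁺ʳ us z∈vs

module _ {α β : Assignment} where

  map-cong-∈ : ∀ {n} (xs : Vec Var n) → (∀ {x} → x ∈ toList xs → α x ≡ β x) →
    Vec.map α xs ≡ Vec.map β xs
  map-cong-∈ Vec.[] _ = refl
  map-cong-∈ (x Vec.∷ xs) α≗β = cong₂ Vec._∷_ (α≗β (here refl)) (map-cong-∈ xs (α≗β ∘ there))

  sat-cong : ∀ S → (∀ {x} → x ∈ vars S → α x ≡ β x) → sat α S → sat β S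
  sat-cong [] _ [] = []
  sat-cong (c ∷ S) α≗β (c✓ ∷ S✓) =
    trans (cong (fn c) (sym (map-cong-∈ (args c) (α≗β ∘ ∈-++⁺ˡ)))) c✓
    ∷ sat-cong S (α≗β ∘ ∈-++⁺ʳ (toList (args c))) S✓

sat-rename⁻ : ∀ {α} f S → sat α (rename f S) → sat (α ∘ f) S
sat-rename⁻ {α} f S = All.map (λ {c} c✓ → trans (cong (fn c) (map-∘ α f (args c))) c✓) ∘ map⁻

sat-rename⁺ : ∀ {α} f S → sat (α ∘ f) S → sat α (rename f S)
sat-rename⁺ {α} f S = map⁺ ∘ All.map (λ {c} c✓ → trans (cong (fn c) (sym (map-∘ α f (args c)))) c✓)

-- Evaluating the new π(S) under α is evaluating the old one under α ∘ redirect a b.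
transpose-∘-preserves-⇒ : ∀ {f a b} S U → rename f S ⇒ U → a ∉ vars U →
  (∀ {x} → x ∈ vars S → f x ≢ b) → rename (transpose a b ∘ f) S ⇒ U
transpose-∘-preserves-⇒ {f} {a} {b} S U f[S]⇒U a∉U f≢b α α⊨S =
  sat-cong U (λ v∈U → cong α (redirect-≢ (λ { refl → a∉U v∈U })))
    (f[S]⇒U (α ∘ redirect a b)
      (sat-rename⁺ f S (sat-cong S (cong α ∘ transpose≡redirect ∘ f≢b)
        (sat-rename⁻ (transpose a b ∘ f) S α⊨S))))

to-injective : (π : Var ↔ Var) → Injective _≡_ _≡_ (Inverse.to π)
to-injective π = Injection.injective (↔⇒↣ π)

transpose-∘-IsPermOf : ∀ {π V x y} → IsPermOf π V → x ∈ V → y ∈ V →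
  IsPermOf (transpose↔ (Inverse.to π x) (Inverse.to π y) ↔-∘ π) V
transpose-∘-IsPermOf {π} {V} πPerm x∈V y∈V v v∉V =
  trans (cong (transpose _ _) (πPerm v v∉V))
    (transpose-≢ (fixed-≢ x∈V) (fixed-≢ y∈V))
  where
  fixed-≢ : ∀ {w} → w ∈ V → v ≢ Inverse.to π w
  fixed-≢ w∈V v≡πw = v∉V (subst (_∈ V) (sym (to-injective π (trans (πPerm v v∉V) v≡πw))) w∈V)

IsoImpliesVia : (Var ↔ Var) → ConstraintSet → ConstraintSet → Set
IsoImpliesVia π S U = IsPermOf π (vars S ++ vars U) × (rename (Inverse.to π) S ⇒ U)

module _ (S U : ConstraintSet)
  (S≥U : numVars S ≥ numVars U)
  (X∩Y≡∅ : (x : Var) → x ∈ vars S → x ∉ vars U) where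

  private
    X = vars S
    Y = vars U

  ¬maps-into : ∀ {f y} → Injective _≡_ _≡_ f → y ∈ Y → f y ∈ Y →
    ¬ All (λ x → f x ∈ Y) X
  ¬maps-into {f} {y} f-inj y∈Y fy∈Y fX⊆Y = <-irrefl refl (≤-trans |y∷X|≤|Y| S≥U)
    where
    X! = deduplicate _≟_ X
    y∉X! : All (y ≢_) X!
    y∉X! = All.tabulate λ z∈X! → λ { refl → X∩Y≡∅ y (∈-deduplicate⁻ _≟_ X z∈X!) y∈Y }
    f[y∷X!]⊆Y! : List.map f (y ∷ X!) ⊆ deduplicate _≟_ Y
    f[y∷X!]⊆Y! z∈ with ∈-map⁻ f z∈
    ... | _ , here refl , refl = ∈-deduplicate⁺ _≟_ fy∈Y
    ... | _ , there w∈X! , refl = ∈-deduplicate⁺ _≟_ (All.lookup fX⊆Y (∈-deduplicate⁻ _≟_ X w∈X!))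
    |y∷X|≤|Y| : suc (length X!) ≤ numVars U
    |y∷X|≤|Y| = subst (_≤ numVars U) (length-map f (y ∷ X!))
      (unique⊆⇒length≤ (Unique.map⁺ f-inj (y∉X! ∷ deduplicate-! X)) f[y∷X!]⊆Y!)

  escape : ∀ {f y} → Injective _≡_ _≡_ f → y ∈ Y → f y ∈ Y → ∃ λ x → x ∈ X × f x ∉ Y
  escape {f} f-inj y∈Y fy∈Y =
    find (¬All⇒Any¬ (λ x → f x ∈? Y) X (¬maps-into f-inj y∈Y fy∈Y))

  move-out : ∀ {π y} → IsoImpliesVia π S U → y ∈ Y →
    Σ (Var ↔ Var) λ π′ → IsoImpliesVia π′ S U × Inverse.to π′ y ∉ Y ×
      (∀ {z} → z ∈ Y → z ≢ y → Inverse.to π′ z ≡ Inverse.to π z)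
  move-out {π} {y} (πPerm , π[S]⇒U) y∈Y with Inverse.to π y ∈? Y
  ... | no πy∉Y = π , (πPerm , π[S]⇒U) , πy∉Y , λ _ _ → refl
  ... | yes πy∈Y with escape (to-injective π) y∈Y πy∈Y
  ...   | x , x∈X , πx∉Y =
    π′ , (π′Perm , π′[S]⇒U) , subst (_∉ Y) (sym (transpose-ʳ a b)) πx∉Y , frame
    where
    p = Inverse.to π
    a = p x
    b = p y
    π′ = transpose↔ a b ↔-∘ π
    π′Perm : IsPermOf π′ (X ++ Y)
    π′Perm = transpose-∘-IsPermOf {π} πPerm (∈-++⁺ˡ x∈X) (∈-++⁺ʳ X y∈Y)
    π′[S]⇒U : rename (Inverse.to π′) S ⇒ U
    π′[S]⇒U = transpose-∘-preserves-⇒ S U π[S]⇒U πx∉Y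
      (λ {w} w∈X pw≡b → X∩Y≡∅ w w∈X (subst (_∈ Y) (sym (to-injective π pw≡b)) y∈Y))
    frame : ∀ {z} → z ∈ Y → z ≢ y → transpose a b (p z) ≡ p z
    frame z∈Y z≢y = transpose-≢
      (λ pz≡a → X∩Y≡∅ x x∈X (subst (_∈ Y) (to-injective π pz≡a) z∈Y))
      (z≢y ∘ to-injective π)

  move-all-out : ∀ {π} ys → ys ⊆ Y → IsoImpliesVia π S U →
    Σ (Var ↔ Var) λ π′ → IsoImpliesVia π′ S U × (∀ {y} → y ∈ ys → Inverse.to π′ y ∉ Y)
  move-all-out {π} [] _ π✓ = π , π✓ , λ ()
  move-all-out {π} (y ∷ ys) y∷ys⊆Y π✓ with move-all-out {π} ys (y∷ys⊆Y ∘ there) π✓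
  ... | π₁ , π₁✓ , ys-out with move-out {π₁} π₁✓ (y∷ys⊆Y (here refl))
  ...   | π₂ , π₂✓ , y-out , frame = π₂ , π₂✓ , out
    where
    out : ∀ {z} → z ∈ y ∷ ys → Inverse.to π₂ z ∉ Y
    out (here refl) = y-out
    out {z} (there z∈ys) with z ≟ y
    ... | yes refl = y-out
    ... | no z≢y = subst (_∉ Y) (sym (frame (y∷ys⊆Y (there z∈ys)) z≢y)) (ys-out z∈ys)

mainTheorem9 : (S U : ConstraintSet) →
    IsoImplies S U →
    numVars S ≥ numVars U →
    ((x : Var) → x ∈ vars S → x ∉ vars U) →
    Σ (Var ↔ Var) λ π →
    IsPermOf π (vars S ++ vars U) ×
    (rename (Inverse.to π) S ⇒ U) ×
    ((y : Var) → y ∈ vars U → Inverse.to π y ∉ vars U)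
mainTheorem9 S U (π , π✓) S≥U X∩Y≡∅ with move-all-out S U S≥U X∩Y≡∅ {π} (vars U) (λ y∈Y → y∈Y) π✓
... | π′ , (π′Perm , π′[S]⇒U) , Y-out = π′ , π′Perm , π′[S]⇒U , λ _ → Y-out
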